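{- Consider the problem OWA $\mathcal{P}$: given $\mathcal{X}\subseteq\{0,1\}^n$, nonnegative cost vectors $\pmb{c}_1,\dots,\pmb{c}_K\in\mathbb{R}^n_{\ge0}$ and a weight vector $\pmb{w}$ with $w_k\in[0,1]$, $\sum_k w_k=1$ and $w_1\ge w_2\ge\dots\ge w_K$, minimize $\mathrm{OWA}_{\pmb{w}}(\pmb{c}_1^T\pmb{x},\dots,\pmb{c}_K^T\pmb{x})$ over $\pmb{x}\in\mathcal{X}$. Let $\ell\ge1$ be an integer with $K$ a multiple of $\ell$. The $\ell$-Aggregation Algorithm returns an optimal solution $\overline{\pmb{x}}$ of the instance of OWA $\mathcal{P}$ with the $K/\ell$ objectives $\overline{\pmb{c}}_k=\frac{1}{\ell}(\pmb{c}_{(k-1)\ell+1}+\dots+\pmb{c}_{k\ell})$, $k\in[K/\ell]$, and weights $\overline{w}_k=w_{(k-1)\ell+1}+\dots+w_{k\ell}$, $k\in[K/\ell]$. Then the $\ell$-Aggregation Algorithm has approximation ratio $\rho\ell$, i.e. $$\mathrm{OWA}_{\pmb{w}}(\pmb{c}_1^T\overline{\pmb{x}},\dots,\pmb{c}_K^T\overline{\pmb{x}})\le \rho\ell\cdot\min_{\pmb{x}\in\mathcal{X}}\mathrm{OWA}_{\pmb{w}}(\pmb{c}_1^T\pmb{x},\dots,\pmb{c}_K^T\pmb{x}),$$ where $\rho=\max_{k\in[K/\ell]}\frac{\sum_{i=1}^k w_i}{\sum_{i=1}^k\overline{w}_i}$.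
   Context: $[m]=\{1,\dots,m\}$. For a real vector $\pmb{b}=(b_1,\dots,b_m)$ and a weight vector $\pmb{v}=(v_1,\dots,v_m)$ (nonnegative, summing to 1), $\mathrm{OWA}_{\pmb{v}}(\pmb{b})=\sum_{k\in[m]}v_k b_{\tau(k)}$, where $\tau$ is a permutation of $[m]$ with $b_{\tau(1)}\ge\dots\ge b_{\tau(m)}$.
   Formalization: The cost vectors $\pmb{c}_1,\dots,\pmb{c}_K$ and the weights $w_k$ are rational rather than real. -}

module Defs where

open import Data.Bool using (Bool; if_then_else_)
open import Data.Nat as ℕ using (ℕ; zero; suc)
open import Data.Fin using (Fin; zero; suc; combine; toℕ)
open import Data.List as List using (List)
open import Data.Integer using (+_)
open import Data.Rational using (ℚ; 0ℚ; _+_; _*_; _÷_; _⊔_; _/_; _≟_; ≢-nonZero)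
open import Data.Rational.Properties using (≤-decTotalOrder)
open import Data.List.Sort ≤-decTotalOrder using (sort)
open import Relation.Nullary using (yes; no)

Σ : ∀ {m} → (Fin m → ℚ) → ℚ
Σ {zero}  f = 0ℚ
Σ {suc m} f = f zero + Σ (λ i → f (suc i))

-- Prefix sum: psum f k = f 1 + ... + f k (1-based; k capped at the length).
psum : ∀ {N} → (Fin N → ℚ) → ℕ → ℚ
psum {N}     f zero    = 0ℚ
psum {zero}  f (suc k) = 0ℚ
psum {suc N} f (suc k) = f zero + psum (λ i → f (suc i)) k

sumL : List ℚ → ℚ
sumL = List.foldr _+_ 0ℚ

sortDesc : ∀ {m} → (Fin m → ℚ) → List ℚ
sortDesc b = List.reverse (sort (List.tabulate b))

OWA : ∀ {m} → (v : Fin m → ℚ) → (b : Fin m → ℚ) → ℚ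
OWA v b = sumL (List.zipWith _*_ (List.tabulate v) (sortDesc b))

dot : ∀ {n} → (Fin n → ℚ) → (Fin n → Bool) → ℚ
dot c x = Σ (λ j → if x j then c j else 0ℚ)

costs : ∀ {K n} → (Fin K → Fin n → ℚ) → (Fin n → Bool) → Fin K → ℚ
costs c x k = dot (c k) x

aggCost : ∀ {m n} (ℓ : ℕ) .{{_ : ℕ.NonZero ℓ}} →
          (Fin (m ℕ.* ℓ) → Fin n → ℚ) → Fin m → Fin n → ℚ
aggCost ℓ c k j = (+ 1 / ℓ) * Σ (λ i → c (combine k i) j)

aggWeight : ∀ {m} (ℓ : ℕ) → (Fin (m ℕ.* ℓ) → ℚ) → Fin m → ℚ
aggWeight ℓ w k = Σ (λ i → w (combine k i))

-- Division p / q; the fallback value for q = 0 is never used in the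
-- theorem (the denominators there are ≥ w_1 > 0).
div : ℚ → ℚ → ℚ
div p q with q ≟ 0ℚ
... | yes _  = 0ℚ
... | no q≢0 = (p ÷ q) {{≢-nonZero q≢0}}

-- Maximum over Fin m (of nonnegative values; 0 for m = 0).
maxF : ∀ {m} → (Fin m → ℚ) → ℚ
maxF {zero}  f = 0ℚ
maxF {suc m} f = f zero ⊔ maxF (λ i → f (suc i))

rho : ∀ {m} (ℓ : ℕ) → (Fin (m ℕ.* ℓ) → ℚ) → ℚ
rho {m} ℓ w = maxF {m} (λ k → div (psum w (suc (toℕ k)))
                                   (psum (aggWeight {m} ℓ w) (suc (toℕ k))))

{-# OPTIONS --safe #-}
-- Let b be the cost vector of a solution and b̄ its blockwise averages, the cost vector of
-- the same solution in the aggregated instance. OWA_w(b) pairs w with the nonincreasingly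
-- sorted b; as w is nonincreasing, Abel summation reduces comparisons of such pairings to
-- comparisons of prefix sums of sorted vectors. These are controlled by excess sums, because
-- the k largest entries of a vector a sum to min_t (k t + Σ_i (a_i - t)⁺).
-- Convexity of (· - t)⁺ shows that sorted b̄, each entry repeated ℓ times, has smaller prefix
-- sums than sorted b, whence OWA_w̄(b̄) ≤ OWA_w(b). Superadditivity of (· - t)⁺ for t ≥ 0
-- shows that sorted b has smaller prefix sums than ℓ times sorted b̄ padded with zeros, whence
-- OWA_w(b) ≤ ℓ Σ_j w_j b̄_(j), with b̄_(j) the j-th largest entry of b̄. A second Abel
-- summation, with the sorted b̄ as weights and the prefix sums of w at most ρ times those of
-- w̄, bounds this by ρ ℓ OWA_w̄(b̄). Chaining both bounds through the optimality of x̄ for the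
-- aggregated instance gives the ratio ρℓ.
module Submission where

open import Defs
open import Algebra.Bundles using (CommutativeRing)
import Algebra.Properties.Semiring.Sum as SemiringSum
open import Data.Bool using (Bool; true; false; if_then_else_)
open import Data.Empty using (⊥-elim)
open import Data.Fin as Fin using (Fin; zero; suc; toℕ; combine; quotient; _↑ˡ_; _↑ʳ_)
open import Data.Fin.Properties using (remQuot-combine; toℕ-fromℕ<)
open import Data.Integer as ℤ using (+_)
import Data.Integer.Properties as ℤP
open import Data.List as List using (List; []; _∷_)
import Data.List.Properties as ListP
open import Data.List.Relation.Unary.All using (All; []; _∷_)
import Data.List.Relation.Unary.All.Properties as AllP
open import Data.List.Relation.Unary.Linked using (Linked; []; [-]; _∷_)
open import Data.List.Relation.Binary.Permutation.Propositional using (_↭_; ↭-sym; ↭-trans; ↭⇒↭ₛ)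
import Data.List.Relation.Binary.Permutation.Propositional.Properties as PermP
open import Data.List.Relation.Binary.Permutation.Setoid.Properties using (foldr-commMonoid)
open import Data.Nat as ℕ using (ℕ; zero; suc; z≤n; s≤s)
import Data.Nat.Properties as ℕP
import Data.Nat.Coprimality as Coprimality
open import Data.Product using (proj₁)
open import Data.Rational as ℚ using (ℚ; 0ℚ; 1ℚ; _+_; _*_; _-_; -_; _⊔_; _/_; mkℚ; _≤_; _<_; _≥_)
import Data.Rational.Properties as ℚP
open import Data.Rational.Solver using (module +-*-Solver)
open import Data.List.Sort ℚP.≤-decTotalOrder using (sort; sort-↭; sort-↗)
open import Data.Sum using (inj₁; inj₂)
open import Function using (_∘_)
open import Relation.Binary.Definitions using (Antitonic₁)
open import Relation.Binary.PropositionalEquality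
  using (_≡_; refl; sym; trans; cong; cong₂; subst; subst₂; setoid)
open import Relation.Nullary using (yes; no)

open +-*-Solver
open ℚP using (≤-refl; ≤-trans; ≤-reflexive; +-mono-≤; +-monoˡ-≤; +-monoʳ-≤)
open ℚP.≤-Reasoning
open SemiringSum (CommutativeRing.semiring ℚP.+-*-commutativeRing)
  using (sum; ∑-distrib-+; ∑-comm; *-distribˡ-sum; *-distribʳ-sum)

*-monoˡ-≤ : ∀ {r p q} → 0ℚ ≤ r → p ≤ q → r * p ≤ r * q
*-monoˡ-≤ {r} 0≤r = ℚP.*-monoˡ-≤-nonNeg r {{ℚ.nonNegative 0≤r}}

*-nonNeg : ∀ {p q} → 0ℚ ≤ p → 0ℚ ≤ q → 0ℚ ≤ p * q
*-nonNeg {p} 0≤p 0≤q = ≤-trans (≤-reflexive (sym (ℚP.*-zeroʳ p))) (*-monoˡ-≤ 0≤p 0≤q)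

p≤p+q : ∀ {p q} → 0ℚ ≤ q → p ≤ p + q
p≤p+q {p} 0≤q = ≤-trans (≤-reflexive (sym (ℚP.+-identityʳ p))) (+-monoʳ-≤ p 0≤q)

p≤q+p : ∀ {p q} → 0ℚ ≤ q → p ≤ q + p
p≤q+p {p} {q} 0≤q = ≤-trans (p≤p+q 0≤q) (≤-reflexive (ℚP.+-comm p q))

p≤q⇒p-q≤0 : ∀ {p q} → p ≤ q → p - q ≤ 0ℚ
p≤q⇒p-q≤0 {p} {q} p≤q = ≤-trans (+-monoˡ-≤ (- q) p≤q) (≤-reflexive (ℚP.+-inverseʳ q))

p≤q⇒0≤q-p : ∀ {p q} → p ≤ q → 0ℚ ≤ q - p
p≤q⇒0≤q-p {p} {q} p≤q = ≤-trans (≤-reflexive (sym (ℚP.+-inverseʳ p))) (+-monoˡ-≤ (- p) p≤q)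

0≤n/1 : ∀ n → 0ℚ ≤ + n / 1
0≤n/1 n = ℚP.nonNegative⁻¹ _ {{ℚP.normalize-nonNeg n 1}}

0≤1/n : ∀ n .{{_ : ℕ.NonZero n}} → 0ℚ ≤ + 1 / n
0≤1/n n = ℚP.nonNegative⁻¹ _ {{ℚP.normalize-nonNeg 1 n}}

n/1≡mkℚ : ∀ n → + n / 1 ≡ mkℚ (+ n) 0 (Coprimality.sym (Coprimality.1-coprimeTo n))
n/1≡mkℚ n = ℚP.normalize-coprime (Coprimality.sym (Coprimality.1-coprimeTo n))

[1+n]/1≡1+n/1 : ∀ n → + suc n / 1 ≡ 1ℚ + + n / 1
[1+n]/1≡1+n/1 n rewrite n/1≡mkℚ n = cong (λ i → i / 1) (cong (ℤ._+_ (+ 1)) (sym (ℤP.*-identityʳ (+ n))))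

n/1*1/n≡1 : ∀ n .{{_ : ℕ.NonZero n}} → (+ n / 1) * (+ 1 / n) ≡ 1ℚ
n/1*1/n≡1 (suc n) rewrite n/1≡mkℚ (suc n) | ℚP.normalize-coprime (Coprimality.1-coprimeTo (suc n)) =
  ℚP.*-inverseʳ (mkℚ (+ suc n) 0 (Coprimality.sym (Coprimality.1-coprimeTo (suc n))))

Σ-cong : ∀ {n} {f g : Fin n → ℚ} → (∀ i → f i ≡ g i) → Σ f ≡ Σ g
Σ-cong {zero}  f≡g = refl
Σ-cong {suc n} f≡g = cong₂ _+_ (f≡g zero) (Σ-cong (f≡g ∘ suc))

Σ-mono-≤ : ∀ {n} {f g : Fin n → ℚ} → (∀ i → f i ≤ g i) → Σ f ≤ Σ g
Σ-mono-≤ {zero}  f≤g = ≤-refl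
Σ-mono-≤ {suc n} f≤g = +-mono-≤ (f≤g zero) (Σ-mono-≤ (f≤g ∘ suc))

Σ-nonNeg : ∀ {n} {f : Fin n → ℚ} → (∀ i → 0ℚ ≤ f i) → 0ℚ ≤ Σ f
Σ-nonNeg {zero}  f≥0 = ≤-refl
Σ-nonNeg {suc n} f≥0 = +-mono-≤ (f≥0 zero) (Σ-nonNeg (f≥0 ∘ suc))

Σ-zero : ∀ n → Σ {n} (λ _ → 0ℚ) ≡ 0ℚ
Σ-zero zero    = refl
Σ-zero (suc n) = cong (_+_ 0ℚ) (Σ-zero n)

Σ-const : ∀ n p → Σ {n} (λ _ → p) ≡ (+ n / 1) * p
Σ-const zero    p = sym (ℚP.*-zeroˡ p)
Σ-const (suc n) p = begin-equality
  p + Σ {n} (λ _ → p)  ≡⟨ cong (_+_ p) (Σ-const n p) ⟩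
  p + (+ n / 1) * p    ≡⟨ solve 2 (λ p q → p :+ q :* p := (con 1ℚ :+ q) :* p) refl p (+ n / 1) ⟩
  (1ℚ + + n / 1) * p   ≡⟨ cong (_* p) ([1+n]/1≡1+n/1 n) ⟨
  (+ suc n / 1) * p    ∎

Σ≡sum : ∀ {n} (f : Fin n → ℚ) → Σ f ≡ sum f
Σ≡sum {zero}  f = refl
Σ≡sum {suc n} f = cong (_+_ (f zero)) (Σ≡sum (f ∘ suc))

Σ-distrib-+ : ∀ {n} (f g : Fin n → ℚ) → Σ (λ i → f i + g i) ≡ Σ f + Σ g
Σ-distrib-+ f g rewrite Σ≡sum (λ i → f i + g i) | Σ≡sum f | Σ≡sum g = ∑-distrib-+ f g

*-distribˡ-Σ : ∀ {n} p (f : Fin n → ℚ) → p * Σ f ≡ Σ (λ i → p * f i)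
*-distribˡ-Σ p f rewrite Σ≡sum f | Σ≡sum (λ i → p * f i) = *-distribˡ-sum p f

*-distribʳ-Σ : ∀ {n} p (f : Fin n → ℚ) → Σ f * p ≡ Σ (λ i → f i * p)
*-distribʳ-Σ p f rewrite Σ≡sum f | Σ≡sum (λ i → f i * p) = *-distribʳ-sum p f

Σ-comm : ∀ {m n} (f : Fin m → Fin n → ℚ) → Σ (λ i → Σ (f i)) ≡ Σ (λ j → Σ (λ i → f i j))
Σ-comm f = begin-equality
  Σ (λ i → Σ (f i))                 ≡⟨ Σ-cong (λ i → Σ≡sum (f i)) ⟩
  Σ (λ i → sum (f i))               ≡⟨ Σ≡sum (λ i → sum (f i)) ⟩
  sum (λ i → sum (f i))             ≡⟨ ∑-comm f ⟩
  sum (λ j → sum (λ i → f i j))     ≡⟨ Σ≡sum (λ j → sum (λ i → f i j)) ⟨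
  Σ (λ j → sum (λ i → f i j))       ≡⟨ Σ-cong (λ j → Σ≡sum (λ i → f i j)) ⟨
  Σ (λ j → Σ (λ i → f i j))         ∎

Σ-++ : ∀ a b (f : Fin (a ℕ.+ b) → ℚ) → Σ f ≡ Σ (λ i → f (i ↑ˡ b)) + Σ (λ j → f (a ↑ʳ j))
Σ-++ zero    b f = sym (ℚP.+-identityˡ (Σ f))
Σ-++ (suc a) b f = trans (cong (_+_ (f zero)) (Σ-++ a b (f ∘ suc))) (sym (ℚP.+-assoc (f zero) _ _))

Σ-combine : ∀ m ℓ (f : Fin (m ℕ.* ℓ) → ℚ) → Σ f ≡ Σ {m} (λ j → Σ {ℓ} (λ r → f (combine j r)))
Σ-combine zero    ℓ f = refl
Σ-combine (suc m) ℓ f =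
  trans (Σ-++ ℓ (m ℕ.* ℓ) f) (cong (_+_ (Σ (λ r → f (r ↑ˡ (m ℕ.* ℓ))))) (Σ-combine m ℓ (f ∘ (ℓ ↑ʳ_))))

Σ-quotient : ∀ {m} ℓ (f : Fin (m ℕ.* ℓ) → Fin m → ℚ) →
             Σ (λ i → f i (quotient {m} ℓ i)) ≡ Σ (λ j → Σ (λ r → f (combine j r) j))
Σ-quotient {m} ℓ f = trans (Σ-combine m ℓ _) (Σ-cong λ j → Σ-cong λ r →
  cong (f (combine j r) ∘ proj₁) (remQuot-combine j r))

average : ∀ {ℓ} .{{_ : ℕ.NonZero ℓ}} → (Fin ℓ → ℚ) → ℚ
average {ℓ} g = (+ 1 / ℓ) * Σ g

average-nonNeg : ∀ {ℓ} .{{_ : ℕ.NonZero ℓ}} {g : Fin ℓ → ℚ} → (∀ r → 0ℚ ≤ g r) → 0ℚ ≤ average g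
average-nonNeg {ℓ} g≥0 = *-nonNeg (0≤1/n ℓ) (Σ-nonNeg g≥0)

n/1*average : ∀ {ℓ} .{{_ : ℕ.NonZero ℓ}} (g : Fin ℓ → ℚ) → (+ ℓ / 1) * average g ≡ Σ g
n/1*average {ℓ} g = begin-equality
  (+ ℓ / 1) * ((+ 1 / ℓ) * Σ g)   ≡⟨ ℚP.*-assoc (+ ℓ / 1) (+ 1 / ℓ) (Σ g) ⟨
  ((+ ℓ / 1) * (+ 1 / ℓ)) * Σ g   ≡⟨ cong (_* Σ g) (n/1*1/n≡1 ℓ) ⟩
  1ℚ * Σ g                        ≡⟨ ℚP.*-identityˡ (Σ g) ⟩
  Σ g                             ∎

Σ-const-average : ∀ {ℓ} .{{_ : ℕ.NonZero ℓ}} (g : Fin ℓ → ℚ) → Σ {ℓ} (λ _ → average g) ≡ Σ g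
Σ-const-average {ℓ} g = trans (Σ-const ℓ (average g)) (n/1*average g)

-- Excess over a threshold

excess : ℚ → ℚ → ℚ
excess t x = (x - t) ⊔ 0ℚ

excess-nonNeg : ∀ t x → 0ℚ ≤ excess t x
excess-nonNeg t x = ℚP.p≤q⊔p (x - t) 0ℚ

x-t≤excess : ∀ t x → x - t ≤ excess t x
x-t≤excess t x = ℚP.p≤p⊔q (x - t) 0ℚ

x≤t+excess : ∀ t x → x ≤ t + excess t x
x≤t+excess t x = begin
  x                ≡⟨ solve 2 (λ x t → x := t :+ (x :- t)) refl x t ⟩
  t + (x - t)      ≤⟨ +-monoʳ-≤ t (x-t≤excess t x) ⟩
  t + excess t x   ∎

excess-of-≤ : ∀ {t x} → x ≤ t → excess t x ≡ 0ℚ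
excess-of-≤ x≤t = ℚP.p≤q⇒p⊔q≡q (p≤q⇒p-q≤0 x≤t)

excess-of-≥ : ∀ {t x} → t ≤ x → excess t x ≡ x - t
excess-of-≥ t≤x = ℚP.p≥q⇒p⊔q≡p (p≤q⇒0≤q-p t≤x)

excess-mono-≤ : ∀ t {x y} → x ≤ y → excess t x ≤ excess t y
excess-mono-≤ t x≤y = ℚP.⊔-monoˡ-≤ 0ℚ (+-monoˡ-≤ (- t) x≤y)

excess≤self : ∀ {t x} → 0ℚ ≤ t → 0ℚ ≤ x → excess t x ≤ x
excess≤self {t} {x} 0≤t 0≤x = ℚP.⊔-lub x-t≤x 0≤x
  where
  x-t≤x : x - t ≤ x
  x-t≤x = ≤-trans (+-monoʳ-≤ x (ℚP.neg-antimono-≤ 0≤t)) (≤-reflexive (ℚP.+-identityʳ x))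

excess-superadditive : ∀ {t a b} → 0ℚ ≤ t → 0ℚ ≤ a → 0ℚ ≤ b →
                       excess t a + excess t b ≤ excess t (a + b)
excess-superadditive {t} {a} {b} 0≤t 0≤a 0≤b with ℚP.≤-total a t
... | inj₁ a≤t = begin
  excess t a + excess t b   ≡⟨ cong (_+ excess t b) (excess-of-≤ a≤t) ⟩
  0ℚ + excess t b           ≡⟨ ℚP.+-identityˡ _ ⟩
  excess t b                ≤⟨ excess-mono-≤ t (p≤q+p 0≤a) ⟩
  excess t (a + b)          ∎
... | inj₂ t≤a = begin
  excess t a + excess t b   ≤⟨ +-mono-≤ (≤-reflexive (excess-of-≥ t≤a)) (excess≤self 0≤t 0≤b) ⟩
  (a - t) + b               ≡⟨ solve 3 (λ a t b → (a :- t) :+ b := (a :+ b) :- t) refl a t b ⟩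
  (a + b) - t               ≡⟨ excess-of-≥ (≤-trans t≤a (p≤p+q 0≤b)) ⟨
  excess t (a + b)          ∎

Σ-excess≤excess-Σ : ∀ {n t} (g : Fin n → ℚ) → 0ℚ ≤ t → (∀ r → 0ℚ ≤ g r) →
                    Σ (λ r → excess t (g r)) ≤ excess t (Σ g)
Σ-excess≤excess-Σ {zero}  {t} g 0≤t g≥0 = excess-nonNeg t 0ℚ
Σ-excess≤excess-Σ {suc n} {t} g 0≤t g≥0 = begin
  excess t (g zero) + Σ (λ r → excess t (g (suc r)))
    ≤⟨ +-monoʳ-≤ (excess t (g zero)) (Σ-excess≤excess-Σ (g ∘ suc) 0≤t (g≥0 ∘ suc)) ⟩
  excess t (g zero) + excess t (Σ (g ∘ suc))
    ≤⟨ excess-superadditive 0≤t (g≥0 zero) (Σ-nonNeg (g≥0 ∘ suc)) ⟩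
  excess t (Σ g) ∎

Σ-excess-average≤Σ-excess : ∀ {ℓ} .{{_ : ℕ.NonZero ℓ}} t (g : Fin ℓ → ℚ) →
                                Σ {ℓ} (λ _ → excess t (average g)) ≤ Σ (λ r → excess t (g r))
Σ-excess-average≤Σ-excess {ℓ} t g with ℚP.≤-total (average g) t
... | inj₁ avg≤t = begin
  Σ {ℓ} (λ _ → excess t (average g))   ≡⟨ Σ-cong {ℓ} (λ _ → excess-of-≤ avg≤t) ⟩
  Σ {ℓ} (λ _ → 0ℚ)                     ≡⟨ Σ-zero ℓ ⟩
  0ℚ                                   ≤⟨ Σ-nonNeg (λ r → excess-nonNeg t (g r)) ⟩
  Σ (λ r → excess t (g r))             ∎
... | inj₂ t≤avg = begin
  Σ {ℓ} (λ _ → excess t (average g))   ≡⟨ Σ-cong {ℓ} (λ _ → excess-of-≥ t≤avg) ⟩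
  Σ {ℓ} (λ _ → average g - t)          ≡⟨ Σ-distrib-+ {ℓ} (λ _ → average g) (λ _ → - t) ⟩
  Σ {ℓ} (λ _ → average g) + Σ {ℓ} (λ _ → - t)
                                       ≡⟨ cong (_+ _) (Σ-const-average g) ⟩
  Σ g + Σ {ℓ} (λ _ → - t)              ≡⟨ Σ-distrib-+ g (λ _ → - t) ⟨
  Σ (λ r → g r - t)                    ≤⟨ Σ-mono-≤ (λ r → x-t≤excess t (g r)) ⟩
  Σ (λ r → excess t (g r))             ∎

Σ< : ℕ → (ℕ → ℚ) → ℚ
Σ< n f = Σ {n} (λ i → f (toℕ i))

Σ<-trailing-zeros : ∀ {n N} (f : ℕ → ℚ) → n ℕ.≤ N → (∀ i → n ℕ.≤ i → f i ≡ 0ℚ) → Σ< N f ≡ Σ< n f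
Σ<-trailing-zeros {N = N} f z≤n       f≡0 = trans (Σ-cong {N} (λ i → f≡0 (toℕ i) z≤n)) (Σ-zero N)
Σ<-trailing-zeros         f (s≤s n≤N) f≡0 =
  cong (_+_ (f 0)) (Σ<-trailing-zeros (f ∘ suc) n≤N (λ i n≤i → f≡0 (suc i) (s≤s n≤i)))

padded : List ℚ → ℕ → ℚ
padded []       _       = 0ℚ
padded (x ∷ xs) zero    = x
padded (x ∷ xs) (suc i) = padded xs i

padded-beyond : ∀ xs {i} → List.length xs ℕ.≤ i → padded xs i ≡ 0ℚ
padded-beyond []       _           = refl
padded-beyond (x ∷ xs) (s≤s len≤i) = padded-beyond xs len≤i

padded-tabulate : ∀ {N} (f : Fin N → ℚ) i → padded (List.tabulate f) (toℕ i) ≡ f i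
padded-tabulate f zero    = refl
padded-tabulate f (suc i) = padded-tabulate (f ∘ suc) i

padded-nonNeg : ∀ {xs} → All (0ℚ ≤_) xs → ∀ i → 0ℚ ≤ padded xs i
padded-nonNeg []           i       = ≤-refl
padded-nonNeg (x≥0 ∷ _)    zero    = x≥0
padded-nonNeg (_ ∷ xs≥0)   (suc i) = padded-nonNeg xs≥0 i

sumL-tabulate : ∀ {N} (f : Fin N → ℚ) → sumL (List.tabulate f) ≡ Σ f
sumL-tabulate {zero}  f = refl
sumL-tabulate {suc N} f = cong (_+_ (f zero)) (sumL-tabulate (f ∘ suc))

sumL-map≡Σ< : ∀ (g : ℚ → ℚ) xs → sumL (List.map g xs) ≡ Σ< (List.length xs) (λ i → g (padded xs i))
sumL-map≡Σ< g []       = refl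
sumL-map≡Σ< g (x ∷ xs) = cong (_+_ (g x)) (sumL-map≡Σ< g xs)

sumL-zipWith-*≡Σ< : ∀ xs ys →
  sumL (List.zipWith _*_ xs ys) ≡ Σ< (List.length xs) (λ i → padded xs i * padded ys i)
sumL-zipWith-*≡Σ< []       ys       = refl
sumL-zipWith-*≡Σ< (x ∷ xs) []       = sym (trans
  (Σ-cong {suc (List.length xs)} (λ i → ℚP.*-zeroʳ (padded (x ∷ xs) (toℕ i))))
  (Σ-zero (suc (List.length xs))))
sumL-zipWith-*≡Σ< (x ∷ xs) (y ∷ ys) = cong (_+_ (x * y)) (sumL-zipWith-*≡Σ< xs ys)

sumL-↭ : ∀ {xs ys} → xs ↭ ys → sumL xs ≡ sumL ys
sumL-↭ xs↭ys = foldr-commMonoid (setoid ℚ) ℚP.+-0-isCommutativeMonoid (↭⇒↭ₛ xs↭ys)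

Antitone : (ℕ → ℚ) → Set
Antitone = Antitonic₁ ℕ._≤_ _≤_

step⇒antitone : ∀ {a : ℕ → ℚ} → (∀ i → a (suc i) ≤ a i) → Antitone a
step⇒antitone         step {zero}  {zero}  z≤n       = ≤-refl
step⇒antitone         step {suc j} {zero}  z≤n       =
  ≤-trans (step j) (step⇒antitone step {j} {zero} z≤n)
step⇒antitone {a = a} step {suc i} {suc j} (s≤s i≤j) = step⇒antitone {a = a ∘ suc} (step ∘ suc) i≤j

padded-antitone : ∀ {xs} → Linked _≥_ xs → All (0ℚ ≤_) xs → Antitone (padded xs)
padded-antitone sorted xs≥0 = step⇒antitone (step sorted xs≥0)
  where
  step : ∀ {xs} → Linked _≥_ xs → All (0ℚ ≤_) xs → ∀ i → padded xs (suc i) ≤ padded xs i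
  step []             _            _       = ≤-refl
  step [-]            (x≥0 ∷ [])   zero    = x≥0
  step [-]            _            (suc i) = ≤-refl
  step (x≥y ∷ _)      _            zero    = x≥y
  step (_ ∷ sorted)   (_ ∷ xs≥0)   (suc i) = step sorted xs≥0 i

tabulate-antitone : ∀ {N} (w : Fin N → ℚ) → (∀ i → 0ℚ ≤ w i) → (∀ i j → i Fin.≤ j → w j ≤ w i) →
                    Antitone (padded (List.tabulate w))
tabulate-antitone w w≥0 w↘ = padded-antitone (linked w w↘) (AllP.tabulate⁺ w≥0)
  where
  linked : ∀ {N} (w : Fin N → ℚ) → (∀ i j → i Fin.≤ j → w j ≤ w i) → Linked _≥_ (List.tabulate w)
  linked {zero}        w w↘ = []
  linked {suc zero}    w w↘ = [-]
  linked {suc (suc N)} w w↘ =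
    w↘ zero (suc zero) z≤n ∷ linked (w ∘ suc) (λ i j i≤j → w↘ (suc i) (suc j) (s≤s i≤j))

sortDesc-↭ : ∀ {N} (b : Fin N → ℚ) → sortDesc b ↭ List.tabulate b
sortDesc-↭ b = ↭-trans (PermP.↭-reverse _) (sort-↭ _)

length-sortDesc : ∀ {N} (b : Fin N → ℚ) → List.length (sortDesc b) ≡ N
length-sortDesc b = trans (PermP.↭-length (sortDesc-↭ b)) (ListP.length-tabulate b)

sortDesc-beyond : ∀ {N} (b : Fin N → ℚ) {i} → N ℕ.≤ i → padded (sortDesc b) i ≡ 0ℚ
sortDesc-beyond b N≤i = padded-beyond (sortDesc b) (subst (ℕ._≤ _) (sym (length-sortDesc b)) N≤i)

sortDesc-nonNeg : ∀ {N} (b : Fin N → ℚ) → (∀ i → 0ℚ ≤ b i) → All (0ℚ ≤_) (sortDesc b)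
sortDesc-nonNeg b b≥0 = PermP.All-resp-↭ (↭-sym (sortDesc-↭ b)) (AllP.tabulate⁺ b≥0)

sortDesc-antitone : ∀ {N} (b : Fin N → ℚ) → (∀ i → 0ℚ ≤ b i) → Antitone (padded (sortDesc b))
sortDesc-antitone b b≥0 = padded-antitone (reverse-linked (sort-↗ _)) (sortDesc-nonNeg b b≥0)
  where
  reverseAcc-linked : ∀ {x} xs acc → Linked _≤_ (x ∷ xs) → Linked _≥_ (x ∷ acc) →
                      Linked _≥_ (List.reverseAcc (x ∷ acc) xs)
  reverseAcc-linked []       acc _              acc↘ = acc↘
  reverseAcc-linked (y ∷ ys) acc (x≤y ∷ sorted) acc↘ =
    reverseAcc-linked ys (_ ∷ acc) sorted (x≤y ∷ acc↘)
  reverse-linked : ∀ {xs} → Linked _≤_ xs → Linked _≥_ (List.reverse xs)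
  reverse-linked {[]}     _      = []
  reverse-linked {x ∷ xs} sorted = reverseAcc-linked xs [] sorted [-]

Σ<-sortDesc : ∀ {N} (g : ℚ → ℚ) (b : Fin N → ℚ) →
              Σ< N (λ i → g (padded (sortDesc b) i)) ≡ Σ (λ i → g (b i))
Σ<-sortDesc {N} g b = begin-equality
  Σ< N (λ i → g (padded (sortDesc b) i))
    ≡⟨ cong (λ n → Σ< n (λ i → g (padded (sortDesc b) i))) (length-sortDesc b) ⟨
  Σ< (List.length (sortDesc b)) (λ i → g (padded (sortDesc b) i))
    ≡⟨ sumL-map≡Σ< g (sortDesc b) ⟨
  sumL (List.map g (sortDesc b))       ≡⟨ sumL-↭ (PermP.map⁺ g (sortDesc-↭ b)) ⟩
  sumL (List.map g (List.tabulate b))  ≡⟨ cong sumL (ListP.map-tabulate b g) ⟩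
  sumL (List.tabulate (λ i → g (b i))) ≡⟨ sumL-tabulate (λ i → g (b i)) ⟩
  Σ (λ i → g (b i))                    ∎

OWA≡Σ< : ∀ {N} (v b : Fin N → ℚ) →
         OWA v b ≡ Σ< N (λ i → padded (List.tabulate v) i * padded (sortDesc b) i)
OWA≡Σ< v b = trans (sumL-zipWith-*≡Σ< (List.tabulate v) (sortDesc b))
  (cong (λ n → Σ< n (λ i → padded (List.tabulate v) i * padded (sortDesc b) i))
        (ListP.length-tabulate v))

OWA-cong : ∀ {N} (v : Fin N → ℚ) {b b′ : Fin N → ℚ} → (∀ i → b i ≡ b′ i) → OWA v b ≡ OWA v b′
OWA-cong v b≗b′ = cong (λ xs → sumL (List.zipWith _*_ (List.tabulate v) (List.reverse (sort xs))))
                       (ListP.tabulate-cong b≗b′)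

-- Majorization

Σ<≤threshold+excess : ∀ N k (f : ℕ → ℚ) t → k ℕ.≤ N →
                      Σ< k f ≤ Σ< k (λ _ → t) + Σ< N (λ i → excess t (f i))
Σ<≤threshold+excess N zero f t _ = begin
  0ℚ                                 ≤⟨ Σ-nonNeg {N} (λ i → excess-nonNeg t (f (toℕ i))) ⟩
  Σ< N (λ i → excess t (f i))        ≡⟨ ℚP.+-identityˡ _ ⟨
  0ℚ + Σ< N (λ i → excess t (f i))   ∎
Σ<≤threshold+excess (suc N) (suc k) f t (s≤s k≤N) = begin
  f 0 + Σ< k (f ∘ suc)
    ≤⟨ +-mono-≤ (x≤t+excess t (f 0)) (Σ<≤threshold+excess N k (f ∘ suc) t k≤N) ⟩
  (t + excess t (f 0)) + (Σ< k (λ _ → t) + Σ< N (λ i → excess t (f (suc i))))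
    ≡⟨ solve 4 (λ a b c d → (a :+ b) :+ (c :+ d) := (a :+ c) :+ (b :+ d))
               refl t (excess t (f 0)) _ _ ⟩
  (t + Σ< k (λ _ → t)) + (excess t (f 0) + Σ< N (λ i → excess t (f (suc i)))) ∎

threshold+excess≤Σ< : ∀ N k (a : ℕ → ℚ) t → k ℕ.≤ N →
                      (∀ i → i ℕ.< k → t ≤ a i) → (∀ i → k ℕ.≤ i → a i ≤ t) →
                      Σ< k (λ _ → t) + Σ< N (λ i → excess t (a i)) ≤ Σ< k a
threshold+excess≤Σ< N zero a t _ _ a≤t = ≤-reflexive (begin-equality
  0ℚ + Σ< N (λ i → excess t (a i))   ≡⟨ ℚP.+-identityˡ _ ⟩
  Σ< N (λ i → excess t (a i))        ≡⟨ Σ-cong {N} (λ i → excess-of-≤ (a≤t (toℕ i) z≤n)) ⟩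
  Σ {N} (λ _ → 0ℚ)                   ≡⟨ Σ-zero N ⟩
  0ℚ                                 ∎)
threshold+excess≤Σ< (suc N) (suc k) a t (s≤s k≤N) t≤a a≤t = begin
  (t + Σ< k (λ _ → t)) + (excess t (a 0) + Σ< N (λ i → excess t (a (suc i))))
    ≡⟨ cong (λ e → (t + Σ< k (λ _ → t)) + (e + Σ< N (λ i → excess t (a (suc i)))))
            (excess-of-≥ (t≤a 0 (s≤s z≤n))) ⟩
  (t + Σ< k (λ _ → t)) + ((a 0 - t) + Σ< N (λ i → excess t (a (suc i))))
    ≡⟨ solve 4 (λ t s x r → (t :+ s) :+ ((x :- t) :+ r) := x :+ (s :+ r)) refl t _ (a 0) _ ⟩
  a 0 + (Σ< k (λ _ → t) + Σ< N (λ i → excess t (a (suc i))))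
    ≤⟨ +-monoʳ-≤ (a 0) (threshold+excess≤Σ< N k (a ∘ suc) t k≤N
                         (λ i i<k → t≤a (suc i) (s≤s i<k)) (λ i k≤i → a≤t (suc i) (s≤s k≤i))) ⟩
  a 0 + Σ< k (a ∘ suc) ∎

excess-dominance⇒prefix-≤ : ∀ N (f a : ℕ → ℚ) → Antitone a → (∀ i → 0ℚ ≤ a i) →
  (∀ t → 0ℚ ≤ t → Σ< N (λ i → excess t (f i)) ≤ Σ< N (λ i → excess t (a i))) →
  ∀ k → k ℕ.≤ N → Σ< k f ≤ Σ< k a
excess-dominance⇒prefix-≤ N f a a↘ a≥0 dominated k k≤N = begin
  Σ< k f
    ≤⟨ Σ<≤threshold+excess N k f t k≤N ⟩
  Σ< k (λ _ → t) + Σ< N (λ i → excess t (f i))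
    ≤⟨ +-monoʳ-≤ (Σ< k (λ _ → t)) (dominated t (a≥0 _)) ⟩
  Σ< k (λ _ → t) + Σ< N (λ i → excess t (a i))
    ≤⟨ threshold+excess≤Σ< N k a t k≤N (λ i i<k → a↘ (ℕP.<⇒≤pred i<k))
                                       (λ i k≤i → a↘ (ℕP.≤-trans ℕP.pred[n]≤n k≤i)) ⟩
  Σ< k a ∎
  where
  t = a (ℕ.pred k)

fuse : (ℕ → ℚ) → ℕ → ℚ
fuse D zero    = D 0 + D 1
fuse D (suc i) = D (suc (suc i))

head-≤ : ∀ {D E : ℕ → ℚ} → Σ< 1 D ≤ Σ< 1 E → D 0 ≤ E 0
head-≤ {D} {E} = subst₂ _≤_ (ℚP.+-identityʳ (D 0)) (ℚP.+-identityʳ (E 0))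

Σ<-fuse : ∀ k D → Σ< (suc k) (fuse D) ≡ Σ< (suc (suc k)) D
Σ<-fuse k D = ℚP.+-assoc (D 0) (D 1) _

-- Abel summation: moving (v₀ - v₁) D₀ out of the sum leaves the weights v₁, v₂, … against
-- the sequence D₀ + D₁, D₂, …, whose prefix sums are prefix sums of D.
prefix-≤⇒weighted-≤ : ∀ n (v D E : ℕ → ℚ) → Antitone v → (∀ i → 0ℚ ≤ v i) →
                      (∀ k → k ℕ.≤ n → Σ< k D ≤ Σ< k E) →
                      Σ< n (λ i → v i * D i) ≤ Σ< n (λ i → v i * E i)
prefix-≤⇒weighted-≤ zero          v D E _  _   _    = ≤-refl
prefix-≤⇒weighted-≤ (suc zero)    v D E _  v≥0 D≤E  =
  +-monoˡ-≤ 0ℚ (*-monoˡ-≤ (v≥0 0) (head-≤ {D} {E} (D≤E 1 (s≤s z≤n))))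
prefix-≤⇒weighted-≤ (suc (suc n)) v D E v↘ v≥0 D≤E = begin
  v 0 * D 0 + (v 1 * D 1 + rest D)
    ≡⟨ abel (v 0) (v 1) (D 0) (D 1) (rest D) ⟩
  (v 0 - v 1) * D 0 + Σ< (suc n) (λ i → v (suc i) * fuse D i)
    ≤⟨ +-mono-≤ (*-monoˡ-≤ (p≤q⇒0≤q-p (v↘ (ℕP.n≤1+n 0))) (head-≤ {D} {E} (D≤E 1 (s≤s z≤n))))
                (prefix-≤⇒weighted-≤ (suc n) (v ∘ suc) (fuse D) (fuse E)
                                     (λ i≤j → v↘ (s≤s i≤j)) (v≥0 ∘ suc) fused-≤) ⟩
  (v 0 - v 1) * E 0 + Σ< (suc n) (λ i → v (suc i) * fuse E i)
    ≡⟨ abel (v 0) (v 1) (E 0) (E 1) (rest E) ⟨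
  v 0 * E 0 + (v 1 * E 1 + rest E) ∎
  where
  rest : (ℕ → ℚ) → ℚ
  rest X = Σ< n (λ i → v (suc (suc i)) * X (suc (suc i)))
  abel : ∀ a b d₀ d₁ r → a * d₀ + (b * d₁ + r) ≡ (a - b) * d₀ + (b * (d₀ + d₁) + r)
  abel = solve 5 (λ a b d₀ d₁ r → a :* d₀ :+ (b :* d₁ :+ r)
                               := (a :- b) :* d₀ :+ (b :* (d₀ :+ d₁) :+ r)) refl
  fused-≤ : ∀ k → k ℕ.≤ suc n → Σ< k (fuse D) ≤ Σ< k (fuse E)
  fused-≤ zero    _         = ≤-refl
  fused-≤ (suc k) (s≤s k≤n) = begin
    Σ< (suc k) (fuse D)         ≡⟨ Σ<-fuse k D ⟩
    Σ< (suc (suc k)) D          ≤⟨ D≤E (suc (suc k)) (s≤s (s≤s k≤n)) ⟩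
    Σ< (suc (suc k)) E          ≡⟨ Σ<-fuse k E ⟨
    Σ< (suc k) (fuse E)         ∎

-- Aggregation

aggregate : ∀ {m} ℓ .{{_ : ℕ.NonZero ℓ}} → (Fin (m ℕ.* ℓ) → ℚ) → Fin m → ℚ
aggregate ℓ b j = average (λ r → b (combine j r))

costs-nonNeg : ∀ {K n} (c : Fin K → Fin n → ℚ) → (∀ k j → 0ℚ ≤ c k j) → ∀ x k → 0ℚ ≤ costs c x k
costs-nonNeg c c≥0 x k = Σ-nonNeg (λ j → selected (x j))
  where
  selected : ∀ {j} β → 0ℚ ≤ (if β then c k j else 0ℚ)
  selected true  = c≥0 k _
  selected false = ≤-refl

costs-aggCost : ∀ {m n} ℓ .{{_ : ℕ.NonZero ℓ}} (c : Fin (m ℕ.* ℓ) → Fin n → ℚ) x j →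
                costs (aggCost {m} ℓ c) x j ≡ aggregate {m} ℓ (costs c x) j
costs-aggCost {m} ℓ c x j = begin-equality
  Σ (λ q → if x q then (+ 1 / ℓ) * Σ (λ r → c (block j r) q) else 0ℚ)
    ≡⟨ Σ-cong (λ q → scale-selected (x q) (λ r → c (block j r) q)) ⟩
  Σ (λ q → (+ 1 / ℓ) * Σ (λ r → if x q then c (block j r) q else 0ℚ))
    ≡⟨ *-distribˡ-Σ (+ 1 / ℓ) (λ q → Σ (λ r → if x q then c (block j r) q else 0ℚ)) ⟨
  (+ 1 / ℓ) * Σ (λ q → Σ (λ r → if x q then c (block j r) q else 0ℚ))
    ≡⟨ cong ((+ 1 / ℓ) *_) (Σ-comm (λ q r → if x q then c (block j r) q else 0ℚ)) ⟩
  (+ 1 / ℓ) * Σ (λ r → Σ (λ q → if x q then c (block j r) q else 0ℚ)) ∎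
  where
  block : Fin m → Fin ℓ → Fin (m ℕ.* ℓ)
  block = combine
  scale-selected : ∀ β (g : Fin ℓ → ℚ) →
                   (if β then (+ 1 / ℓ) * Σ g else 0ℚ) ≡ (+ 1 / ℓ) * Σ (λ r → if β then g r else 0ℚ)
  scale-selected true  g = refl
  scale-selected false g = sym (trans (cong ((+ 1 / ℓ) *_) (Σ-zero ℓ)) (ℚP.*-zeroʳ (+ 1 / ℓ)))

OWA-aggregate≤OWA : ∀ {m} ℓ .{{_ : ℕ.NonZero ℓ}} (w b : Fin (m ℕ.* ℓ) → ℚ) →
                    (∀ i → 0ℚ ≤ w i) → (∀ i j → i Fin.≤ j → w j ≤ w i) → (∀ i → 0ℚ ≤ b i) →
                    OWA (aggWeight {m} ℓ w) (aggregate {m} ℓ b) ≤ OWA w b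
OWA-aggregate≤OWA {m} ℓ w b w≥0 w↘ b≥0 = begin
  OWA w̄ b̄
    ≡⟨ OWA≡Σ< w̄ b̄ ⟩
  Σ< m (λ j → W̄ j * B̄ j)
    ≡⟨ Σ-cong {m} (λ j → cong (_* B̄ (toℕ j)) (padded-tabulate w̄ j)) ⟩
  Σ (λ j → w̄ j * B̄ (toℕ j))
    ≡⟨ Σ-cong {m} (λ j → *-distribʳ-Σ (B̄ (toℕ j)) (λ r → w (block j r))) ⟩
  Σ (λ j → Σ (λ r → w (block j r) * B̄ (toℕ j)))
    ≡⟨ Σ-quotient {m} ℓ (λ i j → w i * B̄ (toℕ j)) ⟨
  Σ (λ i → w i * E i)
    ≡⟨ Σ-cong (λ i → cong₂ _*_ (padded-tabulate w i) (padded-tabulate E i)) ⟨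
  Σ< K (λ i → W i * padded (List.tabulate E) i)
    ≤⟨ prefix-≤⇒weighted-≤ K W (padded (List.tabulate E)) B
         (tabulate-antitone w w≥0 w↘) (padded-nonNeg (AllP.tabulate⁺ w≥0))
         (excess-dominance⇒prefix-≤ K (padded (List.tabulate E)) B
            (sortDesc-antitone b b≥0) (padded-nonNeg (sortDesc-nonNeg b b≥0)) dominated) ⟩
  Σ< K (λ i → W i * B i)
    ≡⟨ OWA≡Σ< w b ⟨
  OWA w b ∎
  where
  K = m ℕ.* ℓ
  block : Fin m → Fin ℓ → Fin K
  block = combine
  w̄ = aggWeight {m} ℓ w
  b̄ = aggregate {m} ℓ b
  W = padded (List.tabulate w)
  W̄ = padded (List.tabulate w̄)
  B = padded (sortDesc b)
  B̄ = padded (sortDesc b̄)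
  -- E repeats each entry of the sorted b̄ over a block of ℓ positions, so that
  -- OWA_w̄(b̄) = Σ_i w_i E_i.
  E : Fin K → ℚ
  E i = B̄ (toℕ (quotient {m} ℓ i))
  dominated : ∀ t → 0ℚ ≤ t →
              Σ< K (λ i → excess t (padded (List.tabulate E) i)) ≤ Σ< K (λ i → excess t (B i))
  dominated t _ = begin
    Σ< K (λ i → excess t (padded (List.tabulate E) i))
      ≡⟨ Σ-cong (λ i → cong (excess t) (padded-tabulate E i)) ⟩
    Σ (λ i → excess t (E i))
      ≡⟨ Σ-quotient {m} ℓ (λ _ j → excess t (B̄ (toℕ j))) ⟩
    Σ< m (λ j → Σ {ℓ} (λ _ → excess t (B̄ j)))
      ≡⟨ Σ<-sortDesc (λ y → Σ {ℓ} (λ _ → excess t y)) b̄ ⟩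
    Σ (λ j → Σ {ℓ} (λ _ → excess t (b̄ j)))
      ≤⟨ Σ-mono-≤ (λ j → Σ-excess-average≤Σ-excess t (λ r → b (block j r))) ⟩
    Σ (λ j → Σ (λ r → excess t (b (block j r))))
      ≡⟨ Σ-combine m ℓ (λ i → excess t (b i)) ⟨
    Σ (λ i → excess t (b i))
      ≡⟨ Σ<-sortDesc (excess t) b ⟨
    Σ< K (λ i → excess t (B i)) ∎

-- The ratio ρ

f≤maxF : ∀ {m} (f : Fin m → ℚ) i → f i ≤ maxF f
f≤maxF f zero    = ℚP.p≤p⊔q _ _
f≤maxF f (suc i) = ≤-trans (f≤maxF (f ∘ suc) i) (ℚP.p≤q⊔p (f zero) _)

0≤maxF : ∀ {m} (f : Fin m → ℚ) → 0ℚ ≤ maxF f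
0≤maxF {zero}  f = ≤-refl
0≤maxF {suc m} f = ≤-trans (0≤maxF (f ∘ suc)) (ℚP.p≤q⊔p (f zero) _)

div≤⇒≤* : ∀ {p q r} → 0ℚ < q → div p q ≤ r → p ≤ r * q
div≤⇒≤* {p} {q} {r} 0<q p/q≤r with q ℚ.≟ 0ℚ
... | yes refl = ⊥-elim (ℚP.<-irrefl refl 0<q)
... | no q≢0 = begin
  p                    ≡⟨ ℚP.*-identityʳ p ⟨
  p * 1ℚ               ≡⟨ cong (p *_) (ℚP.*-inverseˡ q) ⟨
  p * (ℚ.1/ q * q)     ≡⟨ ℚP.*-assoc p (ℚ.1/ q) q ⟨
  (p * ℚ.1/ q) * q     ≤⟨ ℚP.*-monoʳ-≤-nonNeg q {{ℚ.nonNegative (ℚP.<⇒≤ 0<q)}} p/q≤r ⟩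
  r * q                ∎
  where instance _ = ℚ.≢-nonZero q≢0

Σ≡1⇒0<head : ∀ {N} (w : Fin (suc N) → ℚ) → (∀ i j → i Fin.≤ j → w j ≤ w i) → Σ w ≡ 1ℚ → 0ℚ < w zero
Σ≡1⇒0<head {N} w w↘ Σw≡1 with w zero ℚ.≤? 0ℚ
... | no  w₀≰0 = ℚP.≰⇒> w₀≰0
... | yes w₀≤0 = ⊥-elim (ℚP.<-irrefl refl (ℚP.<-≤-trans (ℚP.positive⁻¹ 1ℚ) 1≤0))
  where
  1≤0 : 1ℚ ≤ 0ℚ
  1≤0 = begin
    1ℚ                 ≡⟨ Σw≡1 ⟨
    Σ w                ≤⟨ Σ-mono-≤ (λ i → ≤-trans (w↘ zero i z≤n) w₀≤0) ⟩
    Σ {suc N} (λ _ → 0ℚ) ≡⟨ Σ-zero (suc N) ⟩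
    0ℚ                 ∎

psum≡Σ< : ∀ {N} (f : Fin N → ℚ) k → psum f k ≡ Σ< k (padded (List.tabulate f))
psum≡Σ<         f zero    = refl
psum≡Σ< {zero}  f (suc k) = sym (trans (ℚP.+-identityˡ _) (Σ-zero k))
psum≡Σ< {suc N} f (suc k) = cong (_+_ (f zero)) (psum≡Σ< (f ∘ suc) k)

psum-nonNeg : ∀ {N} (f : Fin N → ℚ) → (∀ i → 0ℚ ≤ f i) → ∀ k → 0ℚ ≤ psum f k
psum-nonNeg f f≥0 k =
  subst (0ℚ ≤_) (sym (psum≡Σ< f k)) (Σ-nonNeg {k} (λ i → padded-nonNeg (AllP.tabulate⁺ f≥0) (toℕ i)))

psum≤rho*psum : ∀ {m} ℓ .{{_ : ℕ.NonZero ℓ}} (w : Fin (m ℕ.* ℓ) → ℚ) →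
                (∀ i → 0ℚ ≤ w i) → (∀ i j → i Fin.≤ j → w j ≤ w i) → Σ w ≡ 1ℚ →
                (k : Fin m) →
                psum w (suc (toℕ k)) ≤ rho {m} ℓ w * psum (aggWeight {m} ℓ w) (suc (toℕ k))
psum≤rho*psum {suc m} (suc l) w w≥0 w↘ Σw≡1 k = div≤⇒≤* 0<psum (f≤maxF ratio k)
  where
  w̄ = aggWeight {suc m} (suc l) w
  ratio : Fin (suc m) → ℚ
  ratio k = div (psum w (suc (toℕ k))) (psum w̄ (suc (toℕ k)))
  w̄≥0 : ∀ j → 0ℚ ≤ w̄ (suc j)
  w̄≥0 j = Σ-nonNeg {suc l} (λ r → w≥0 (combine (suc j) r))
  0<psum : 0ℚ < psum w̄ (suc (toℕ k))
  0<psum = begin-strict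
    0ℚ                     <⟨ Σ≡1⇒0<head w w↘ Σw≡1 ⟩
    w zero                 ≤⟨ p≤p+q (Σ-nonNeg {l} (λ r → w≥0 (combine {suc m} zero (suc r)))) ⟩
    w̄ zero                 ≤⟨ p≤p+q (psum-nonNeg (w̄ ∘ suc) w̄≥0 (toℕ k)) ⟩
    psum w̄ (suc (toℕ k))   ∎

prefix-weights≤rho*prefix-aggWeights : ∀ {m} ℓ .{{_ : ℕ.NonZero ℓ}} (w : Fin (m ℕ.* ℓ) → ℚ) →
  (∀ i → 0ℚ ≤ w i) → (∀ i j → i Fin.≤ j → w j ≤ w i) → Σ w ≡ 1ℚ → ∀ k → k ℕ.≤ m →
  Σ< k (padded (List.tabulate w)) ≤
  Σ< k (λ i → rho {m} ℓ w * padded (List.tabulate (aggWeight {m} ℓ w)) i)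
prefix-weights≤rho*prefix-aggWeights     ℓ w w≥0 w↘ Σw≡1 zero    _   = ≤-refl
prefix-weights≤rho*prefix-aggWeights {m} ℓ w w≥0 w↘ Σw≡1 (suc j) j<m = begin
  Σ< (suc j) W                ≡⟨ psum≡Σ< w (suc j) ⟨
  psum w (suc j)              ≡⟨ cong (λ i → psum w (suc i)) (toℕ-fromℕ< j<m) ⟨
  psum w (suc (toℕ k))        ≤⟨ psum≤rho*psum {m} ℓ w w≥0 w↘ Σw≡1 k ⟩
  ρ * psum w̄ (suc (toℕ k))    ≡⟨ cong (λ i → ρ * psum w̄ (suc i)) (toℕ-fromℕ< j<m) ⟩
  ρ * psum w̄ (suc j)          ≡⟨ cong (ρ *_) (psum≡Σ< w̄ (suc j)) ⟩
  ρ * Σ< (suc j) W̄            ≡⟨ *-distribˡ-Σ {suc j} ρ (λ i → W̄ (toℕ i)) ⟩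
  Σ< (suc j) (λ i → ρ * W̄ i)  ∎
  where
  k = Fin.fromℕ< j<m
  ρ = rho {m} ℓ w
  w̄ = aggWeight {m} ℓ w
  W = padded (List.tabulate w)
  W̄ = padded (List.tabulate w̄)

OWA≤rho*ℓ*OWA-aggregate : ∀ {m} ℓ .{{_ : ℕ.NonZero ℓ}} (w b : Fin (m ℕ.* ℓ) → ℚ) →
  (∀ i → 0ℚ ≤ w i) → (∀ i j → i Fin.≤ j → w j ≤ w i) → Σ w ≡ 1ℚ → (∀ i → 0ℚ ≤ b i) →
  OWA w b ≤ (rho {m} ℓ w * (+ ℓ / 1)) * OWA (aggWeight {m} ℓ w) (aggregate {m} ℓ b)
OWA≤rho*ℓ*OWA-aggregate {m} ℓ w b w≥0 w↘ Σw≡1 b≥0 = begin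
  OWA w b
    ≡⟨ OWA≡Σ< w b ⟩
  Σ< K (λ i → W i * B i)
    ≤⟨ prefix-≤⇒weighted-≤ K W B F
         (tabulate-antitone w w≥0 w↘) (padded-nonNeg (AllP.tabulate⁺ w≥0))
         (excess-dominance⇒prefix-≤ K B F F↘ F≥0 dominated) ⟩
  Σ< K (λ i → W i * F i)
    ≡⟨ Σ<-trailing-zeros (λ i → W i * F i) m≤K
         (λ i m≤i → trans (cong (W i *_) (F-beyond m≤i)) (ℚP.*-zeroʳ (W i))) ⟩
  Σ< m (λ i → W i * (L * B̄ i))
    ≡⟨ Σ-cong {m} (λ i → solve 3 (λ w l y → w :* (l :* y) := l :* (y :* w))
                                 refl (W (toℕ i)) L (B̄ (toℕ i))) ⟩
  Σ< m (λ i → L * (B̄ i * W i))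
    ≡⟨ *-distribˡ-Σ {m} L _ ⟨
  L * Σ< m (λ i → B̄ i * W i)
    ≤⟨ *-monoˡ-≤ (0≤n/1 ℓ) (prefix-≤⇒weighted-≤ m B̄ W (λ i → ρ * W̄ i)
         (sortDesc-antitone b̄ b̄≥0) (padded-nonNeg (sortDesc-nonNeg b̄ b̄≥0))
         (prefix-weights≤rho*prefix-aggWeights {m} ℓ w w≥0 w↘ Σw≡1)) ⟩
  L * Σ< m (λ i → B̄ i * (ρ * W̄ i))
    ≡⟨ cong (L *_) (Σ-cong {m} (λ i → solve 3 (λ y r w → y :* (r :* w) := r :* (w :* y))
                                              refl (B̄ (toℕ i)) ρ (W̄ (toℕ i)))) ⟩
  L * Σ< m (λ i → ρ * (W̄ i * B̄ i))
    ≡⟨ cong (L *_) (*-distribˡ-Σ {m} ρ _) ⟨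
  L * (ρ * Σ< m (λ i → W̄ i * B̄ i))
    ≡⟨ solve 3 (λ l r s → l :* (r :* s) := (r :* l) :* s) refl L ρ _ ⟩
  (ρ * L) * Σ< m (λ i → W̄ i * B̄ i)
    ≡⟨ cong ((ρ * L) *_) (OWA≡Σ< w̄ b̄) ⟨
  (ρ * L) * OWA w̄ b̄ ∎
  where
  K = m ℕ.* ℓ
  L = + ℓ / 1
  ρ = rho {m} ℓ w
  w̄ = aggWeight {m} ℓ w
  b̄ = aggregate {m} ℓ b
  block : Fin m → Fin ℓ → Fin K
  block = combine
  W = padded (List.tabulate w)
  W̄ = padded (List.tabulate w̄)
  B = padded (sortDesc b)
  B̄ = padded (sortDesc b̄)
  F : ℕ → ℚ
  F i = L * B̄ i
  m≤K : m ℕ.≤ K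
  m≤K = ℕP.m≤m*n m ℓ
  b̄≥0 : ∀ j → 0ℚ ≤ b̄ j
  b̄≥0 j = average-nonNeg (λ r → b≥0 (block j r))
  F↘ : Antitone F
  F↘ i≤j = *-monoˡ-≤ (0≤n/1 ℓ) (sortDesc-antitone b̄ b̄≥0 i≤j)
  F≥0 : ∀ i → 0ℚ ≤ F i
  F≥0 i = *-nonNeg (0≤n/1 ℓ) (padded-nonNeg (sortDesc-nonNeg b̄ b̄≥0) i)
  F-beyond : ∀ {i} → m ℕ.≤ i → F i ≡ 0ℚ
  F-beyond m≤i = trans (cong (L *_) (sortDesc-beyond b̄ m≤i)) (ℚP.*-zeroʳ L)
  dominated : ∀ t → 0ℚ ≤ t → Σ< K (λ i → excess t (B i)) ≤ Σ< K (λ i → excess t (F i))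
  dominated t 0≤t = begin
    Σ< K (λ i → excess t (B i))
      ≡⟨ Σ<-sortDesc (excess t) b ⟩
    Σ (λ i → excess t (b i))
      ≡⟨ Σ-combine m ℓ (λ i → excess t (b i)) ⟩
    Σ (λ j → Σ (λ r → excess t (b (block j r))))
      ≤⟨ Σ-mono-≤ (λ j → Σ-excess≤excess-Σ (λ r → b (block j r)) 0≤t (λ r → b≥0 (block j r))) ⟩
    Σ (λ j → excess t (Σ (λ r → b (block j r))))
      ≡⟨ Σ-cong {m} (λ j → cong (excess t) (n/1*average (λ r → b (block j r)))) ⟨
    Σ (λ j → excess t (L * b̄ j))
      ≡⟨ Σ<-sortDesc (λ y → excess t (L * y)) b̄ ⟨
    Σ< m (λ i → excess t (F i))
      ≡⟨ Σ<-trailing-zeros (λ i → excess t (F i)) m≤K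
           (λ i m≤i → excess-of-≤ (≤-trans (≤-reflexive (F-beyond m≤i)) 0≤t)) ⟨
    Σ< K (λ i → excess t (F i)) ∎

theorem1 : (n m ℓ : ℕ) .{{_ : ℕ.NonZero ℓ}}
    → (X : (Fin n → Bool) → Set)
    → (c : Fin (m ℕ.* ℓ) → Fin n → ℚ)
    → (∀ k j → 0ℚ ≤ c k j)
    → (w : Fin (m ℕ.* ℓ) → ℚ)
    → (∀ k → 0ℚ ≤ w k)
    → (∀ k → w k ≤ 1ℚ)
    → Σ w ≡ 1ℚ
    → (∀ i j → i Fin.≤ j → w j ≤ w i)
    → (xbar : Fin n → Bool)
    → X xbar
    → (∀ x → X x → OWA (aggWeight {m} ℓ w) (costs (aggCost {m} ℓ c) xbar)
                     ≤ OWA (aggWeight {m} ℓ w) (costs (aggCost {m} ℓ c) x))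
    → ∀ x → X x
    → OWA w (costs c xbar) ≤ (rho {m} ℓ w * (+ ℓ / 1)) * OWA w (costs c x)
theorem1 n m ℓ X c c≥0 w w≥0 _ Σw≡1 w↘ xbar _ xbar-optimal x x∈X = begin
  OWA w (costs c xbar)
    ≤⟨ OWA≤rho*ℓ*OWA-aggregate {m} ℓ w (costs c xbar) w≥0 w↘ Σw≡1 (costs-nonNeg c c≥0 xbar) ⟩
  ρℓ * OWA w̄ (aggregate {m} ℓ (costs c xbar))
    ≡⟨ cong (ρℓ *_) (OWA-cong w̄ (costs-aggCost {m} ℓ c xbar)) ⟨
  ρℓ * OWA w̄ (costs c̄ xbar)
    ≤⟨ *-monoˡ-≤ 0≤ρℓ (xbar-optimal x x∈X) ⟩
  ρℓ * OWA w̄ (costs c̄ x)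
    ≡⟨ cong (ρℓ *_) (OWA-cong w̄ (costs-aggCost {m} ℓ c x)) ⟩
  ρℓ * OWA w̄ (aggregate {m} ℓ (costs c x))
    ≤⟨ *-monoˡ-≤ 0≤ρℓ (OWA-aggregate≤OWA {m} ℓ w (costs c x) w≥0 w↘ (costs-nonNeg c c≥0 x)) ⟩
  ρℓ * OWA w (costs c x) ∎
  where
  ρℓ = rho {m} ℓ w * (+ ℓ / 1)
  w̄ = aggWeight {m} ℓ w
  c̄ = aggCost {m} ℓ c
  0≤ρℓ : 0ℚ ≤ ρℓ
  0≤ρℓ = *-nonNeg (0≤maxF {m} _) (0≤n/1 ℓ)
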